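{- Let $G$ be a graph and $\mathcal{B}$ a biclique covering of $G$. Then the formula $F_{\mathcal{B}} := \bigwedge_{B\in\mathcal{B}} \mathsf{BIS}(B)$ encodes the independent-set property of $G$, and $|F_{\mathcal{B}}| = \sum_{B\in\mathcal{B}} |V(B)|$.
   Context: Formulas are CNF formulas, i.e., sets of clauses; $|F|$ is the number of clauses. For a formula $F$ and a partial assignment $\tau$ to some of its variables, $F|_\tau$ is obtained by deleting every clause satisfied by $\tau$ and deleting from the remaining clauses every literal falsified by $\tau$. A biclique covering of $G$ is a set of subgraphs of $G$, each a complete bipartite graph, whose edge sets together equal $E(G)$. Encoding the independent-set property: given a graph $G=(V,E)$, variables $X=\{x_v : v\in V\}$ and a (possibly empty) set $Y$ of auxiliary variables, a formula $F$ with variable set $X\cup Y$ encodes the independent-set property of $G$ if for every assignment $\tau: X\to\{\bot,\top\}$, $F|_\tau$ is satisfiable if and only if $\{v\in V : \tau(x_v)=\top\}$ is an independent set of $G$. For a biclique $B$ in $\mathcal{B}$ with parts $P$ and $Q$, introduce a fresh auxiliary variable $y_B$ (distinct for distinct bicliques) and set $\mathsf{BIS}(B) := \bigwedge_{v\in P}(\overline{x_v}\lor y_B)\land\bigwedge_{v\in Q}(\overline{y_B}\lor\overline{x_v})$. -}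

module Defs where

open import Data.Nat using (ℕ; _+_)
open import Data.Bool using (Bool; true; false; not)
open import Data.Maybe using (Maybe; just; nothing)
open import Data.Fin using (Fin)
open import Data.Fin.Subset using (Subset; _∈_; _∉_; ∣_∣)
open import Data.Fin.Subset.Properties using (_∈?_)
open import Data.List using (List; []; _∷_; map; concat; concatMap; filter; length; _++_)
open import Data.Nat.ListAction using (sum)
open import Data.List.Base using (allFin)
open import Data.List.Relation.Unary.All using (All)
open import Data.List.Relation.Unary.Any using (Any)
open import Data.List.Relation.Unary.AllPairs using (AllPairs)
import Data.List.Membership.Propositional as Mem
open import Data.Sum using (_⊎_)
open import Data.Product using (Σ; _×_; ∃; ∃-syntax)
open import Relation.Nullary using (¬_)
open import Relation.Binary.PropositionalEquality using (_≡_)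
open import Function.Bundles using (_⇔_)

record Graph (n : ℕ) : Set₁ where
  field
    Adj      : Fin n → Fin n → Set
    sym      : ∀ {u v} → Adj u v → Adj v u
    irrefl   : ∀ {v} → ¬ Adj v v
open Graph public

record Biclique (n : ℕ) : Set where
  constructor biclique
  field
    P Q : Subset n
open Biclique public

-- |V(B)| = |P| + |Q| (the parts are disjoint)
∣V∣ : ∀ {n} → Biclique n → ℕ
∣V∣ B = ∣ P B ∣ + ∣ Q B ∣

IsBicliqueOf : ∀ {n} → Graph n → Biclique n → Set
IsBicliqueOf G B =
  (∀ v → v ∈ P B → v ∉ Q B) ×
  (∀ u v → u ∈ P B → v ∈ Q B → Adj G u v)

EdgeOf : ∀ {n} → Biclique n → Fin n → Fin n → Set
EdgeOf B u v = (u ∈ P B × v ∈ Q B) ⊎ (u ∈ Q B × v ∈ P B)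

IsBicliqueCovering : ∀ {n m} → Graph n → (Fin m → Biclique n) → Set
IsBicliqueCovering G 𝓑 =
  (∀ i → IsBicliqueOf G (𝓑 i)) ×
  (∀ u v → Adj G u v → ∃[ i ] EdgeOf (𝓑 i) u v)

data Var (n m : ℕ) : Set where
  x : Fin n → Var n m
  y : Fin m → Var n m

data Lit (n m : ℕ) : Set where
  pos : Var n m → Lit n m
  neg : Var n m → Lit n m

Clause : ℕ → ℕ → Set
Clause n m = List (Lit n m)

Formula : ℕ → ℕ → Set
Formula n m = List (Clause n m)

evalLit : ∀ {n m} → (Var n m → Bool) → Lit n m → Bool
evalLit σ (pos v) = σ v
evalLit σ (neg v) = not (σ v)

Satisfiable : ∀ {n m} → Formula n m → Set
Satisfiable F = ∃[ σ ] All (λ C → Any (λ l → evalLit σ l ≡ true) C) F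

PartialAssignment : ℕ → ℕ → Set
PartialAssignment n m = Var n m → Maybe Bool

litVal : ∀ {n m} → PartialAssignment n m → Lit n m → Maybe Bool
litVal τ (pos v) with τ v
... | just b  = just b
... | nothing = nothing
litVal τ (neg v) with τ v
... | just b  = just (not b)
... | nothing = nothing

litSat : ∀ {n m} → PartialAssignment n m → Lit n m → Bool
litSat τ l with litVal τ l
... | just true = true
... | _         = false

litFalse : ∀ {n m} → PartialAssignment n m → Lit n m → Bool
litFalse τ l with litVal τ l
... | just false = true
... | _          = false

anyB : ∀ {A : Set} → (A → Bool) → List A → Bool
anyB p []       = false
anyB p (a ∷ as) with p a
... | true  = true
... | false = anyB p as

filterB : ∀ {A : Set} → (A → Bool) → List A → List A
filterB p []       = []
filterB p (a ∷ as) with p a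
... | true  = a ∷ filterB p as
... | false = filterB p as

restrict : ∀ {n m} → Formula n m → PartialAssignment n m → Formula n m
restrict F τ =
  map (filterB (λ l → not (litFalse τ l)))
      (filterB (λ C → not (anyB (litSat τ) C)) F)

onX : ∀ {n m} → (Fin n → Bool) → PartialAssignment n m
onX τ (x v) = just (τ v)
onX τ (y i) = nothing

IndependentFor : ∀ {n} → Graph n → (Fin n → Bool) → Set
IndependentFor G τ = ∀ u v → τ u ≡ true → τ v ≡ true → ¬ Adj G u v

EncodesIS : ∀ {n m} → Graph n → Formula n m → Set
EncodesIS {n} G F = ∀ (τ : Fin n → Bool) → Satisfiable (restrict F (onX τ)) ⇔ IndependentFor G τ

-- Number of clauses |F| of a formula, viewed as a SET of clauses:
-- F has |F| = k iff its list of clauses has no repetitions (clauses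
-- compared as sets of literals) and has length k.

_≈C_ : ∀ {n m} → Clause n m → Clause n m → Set
C ≈C D = ∀ l → (l Mem.∈ C) ⇔ (l Mem.∈ D)

NoRepeatedClauses : ∀ {n m} → Formula n m → Set
NoRepeatedClauses F = AllPairs (λ C D → ¬ (C ≈C D)) F

HasSize : ∀ {n m} → Formula n m → ℕ → Set
HasSize F k = NoRepeatedClauses F × length F ≡ k

members : ∀ {n} → Subset n → List (Fin n)
members S = filter (_∈? S) (allFin _)

BIS : ∀ {n m} → Fin m → Biclique n → Formula n m
BIS i B =
  map (λ v → neg (x v) ∷ pos (y i) ∷ []) (members (P B)) ++
  map (λ v → neg (y i) ∷ neg (x v) ∷ []) (members (Q B))

F𝓑 : ∀ {n m} → (Fin m → Biclique n) → Formula n m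
F𝓑 {m = m} 𝓑 = concatMap (λ i → BIS i (𝓑 i)) (allFin m)

sumV : ∀ {n m} → (Fin m → Biclique n) → ℕ
sumV {m = m} 𝓑 = sum (map (λ i → ∣V∣ (𝓑 i)) (allFin m))

{-# OPTIONS --safe #-}

-- Under τ, the surviving clauses of BIS(B) reduce to y_B for each true vertex of P and to ¬y_B for
-- each true vertex of Q. So F_𝓑|τ is satisfiable iff no biclique has true vertices on both sides,
-- which, as the bicliques are subgraphs of G covering every edge, means the true vertices are
-- independent; the satisfying assignment sets y_B iff some true vertex lies in P. For the count,
-- (B, v, side) can be read off the literal set of each clause, so no two clauses coincide.

module Submission where

open import Defs
open import Data.Nat using (ℕ; zero; suc; _+_)
open import Data.Fin using (Fin; zero; suc)
open import Data.Bool using (Bool; true; false; not)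
open import Data.Bool.Properties using (not-injective; not-¬) renaming (_≟_ to _≟ᵇ_)
open import Data.Product using (_×_; _,_; proj₁; proj₂; ∃-syntax)
import Data.Product as Product
open import Data.Sum using (inj₁; inj₂)
open import Data.Empty using (⊥-elim)
open import Data.Vec using ([]; _∷_)
open import Data.List using (List; []; _∷_; map; filter; length; tabulate; allFin; concatMap)
open import Data.List.Properties using (length-++; length-map; map-cong)
open import Data.Nat.ListAction using (sum)
open import Data.List.Relation.Unary.All as All using (All; []; _∷_)
import Data.List.Relation.Unary.All.Properties as All
open import Data.List.Relation.Unary.Any using (Any; here; there)
open import Data.List.Relation.Unary.Any.Properties using (singleton⁻)
import Data.List.Relation.Unary.AllPairs as AllPairs
import Data.List.Relation.Unary.AllPairs.Properties as AllPairs
open import Data.List.Relation.Unary.Unique.Propositional using (Unique)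
import Data.List.Relation.Unary.Unique.Propositional.Properties as Unique
open import Data.List.Membership.Propositional using () renaming (_∈_ to _∈ₗ_; _∉_ to _∉ₗ_)
open import Data.List.Membership.Propositional.Properties using (∈-filter⁺; ∈-filter⁻; ∈-allFin)
open import Data.Fin.Subset using (Subset; _∈_; inside; outside; ∣_∣)
open import Data.Fin.Subset.Properties using (_∈?_)
open import Data.Fin.Properties using (any?)
open import Relation.Nullary using (¬_; Dec; does)
open import Relation.Nullary.Decidable using (dec-true; dec-false; _×-dec_)
open import Relation.Binary.PropositionalEquality using (_≡_; _≢_; refl; trans; cong; cong₂)
open import Function using (_∘_; id)
open import Function.Bundles using (_⇔_; mk⇔; Equivalence)
import Function.Properties.Equivalence as ⇔

module _ {A B : Set} (p : A → Bool) (f : A → B) {R : B → Set} where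

  All-map-filterB⁺ : ∀ xs → All (λ a → p a ≡ true → R (f a)) xs → All R (map f (filterB p xs))
  All-map-filterB⁺ []       []       = []
  All-map-filterB⁺ (a ∷ xs) (h ∷ hs) with p a
  ... | true  = h refl ∷ All-map-filterB⁺ xs hs
  ... | false = All-map-filterB⁺ xs hs

  All-map-filterB⁻ : ∀ xs → All R (map f (filterB p xs)) → All (λ a → p a ≡ true → R (f a)) xs
  All-map-filterB⁻ []       _ = []
  All-map-filterB⁻ (a ∷ xs) hs with p a in pa≡
  All-map-filterB⁻ (a ∷ xs) (h ∷ hs) | true  = (λ _ → h) ∷ All-map-filterB⁻ xs hs
  All-map-filterB⁻ (a ∷ xs) hs       | false =
    (λ pa≡true → ⊥-elim (not-¬ pa≡ pa≡true)) ∷ All-map-filterB⁻ xs hs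

length-concatMap : ∀ {A B : Set} (f : A → List B) xs → length (concatMap f xs) ≡ sum (map (length ∘ f) xs)
length-concatMap f []       = refl
length-concatMap f (a ∷ xs) = trans (length-++ (f a)) (cong (length (f a) +_) (length-concatMap f xs))

module _ {n : ℕ} where

  All-members⁺ : ∀ (S : Subset n) {R : Fin n → Set} → (∀ v → v ∈ S → R v) → All R (members S)
  All-members⁺ S h = All.tabulate λ {v} v∈S → h v (proj₂ (∈-filter⁻ (_∈? S) {xs = allFin n} v∈S))

  All-members⁻ : ∀ (S : Subset n) {R : Fin n → Set} → All R (members S) → ∀ v → v ∈ S → R v
  All-members⁻ S h v v∈S = All.lookup h (∈-filter⁺ (_∈? S) (∈-allFin v) v∈S)

  members-unique : ∀ (S : Subset n) → Unique (members S)
  members-unique S = Unique.filter⁺ (_∈? S) (Unique.allFin⁺ n)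

length-filter-∈?-tabulate-suc : ∀ {n k} s (S : Subset n) (f : Fin k → Fin n) →
  length (filter (_∈? s ∷ S) (tabulate (suc ∘ f))) ≡ length (filter (_∈? S) (tabulate f))
length-filter-∈?-tabulate-suc {k = zero}  s S f = refl
length-filter-∈?-tabulate-suc {k = suc k} s S f with does (f zero ∈? S)
... | true  = cong suc (length-filter-∈?-tabulate-suc s S (f ∘ suc))
... | false = length-filter-∈?-tabulate-suc s S (f ∘ suc)

length-members : ∀ {n} (S : Subset n) → length (members S) ≡ ∣ S ∣
length-members []            = refl
length-members (inside ∷ S)  = cong suc (trans (length-filter-∈?-tabulate-suc inside S id) (length-members S))
length-members (outside ∷ S) = trans (length-filter-∈?-tabulate-suc outside S id) (length-members S)

module _ {n m : ℕ} where

  PClause QClause : Fin m → Fin n → Clause n m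
  PClause i v = neg (x v) ∷ pos (y i) ∷ []
  QClause i v = neg (y i) ∷ neg (x v) ∷ []

  All-BIS⁺ : ∀ i B {R : Clause n m → Set} →
    (∀ v → v ∈ P B → R (PClause i v)) → (∀ v → v ∈ Q B → R (QClause i v)) → All R (BIS i B)
  All-BIS⁺ i B hP hQ = All.++⁺ (All.map⁺ (All-members⁺ (P B) hP)) (All.map⁺ (All-members⁺ (Q B) hQ))

  All-BIS⁻ : ∀ i B {R : Clause n m → Set} → All R (BIS i B) →
    (∀ v → v ∈ P B → R (PClause i v)) × (∀ v → v ∈ Q B → R (QClause i v))
  All-BIS⁻ i B h =
      All-members⁻ (P B) (All.map⁻ (All.++⁻ˡ (map (PClause i) (members (P B))) h))
    , All-members⁻ (Q B) (All.map⁻ (All.++⁻ʳ (map (PClause i) (members (P B))) h))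

  All-F𝓑⁺ : ∀ (𝓑 : Fin m → Biclique n) {R : Clause n m → Set} → (∀ i → All R (BIS i (𝓑 i))) → All R (F𝓑 𝓑)
  All-F𝓑⁺ 𝓑 h = All.concat⁺ (All.map⁺ (All.universal h (allFin m)))

  All-F𝓑⁻ : ∀ (𝓑 : Fin m → Biclique n) {R : Clause n m → Set} → All R (F𝓑 𝓑) → ∀ i → All R (BIS i (𝓑 i))
  All-F𝓑⁻ 𝓑 h i = All.lookup (All.map⁻ (All.concat⁻ h)) (∈-allFin i)

  module _ (τ : Fin n → Bool) where

    kept : Clause n m → Bool
    kept C = not (anyB (litSat (onX τ)) C)

    residual : Clause n m → Clause n m
    residual = filterB (λ l → not (litFalse (onX τ) l))

  Satisfies : (Var n m → Bool) → Clause n m → Set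
  Satisfies σ C = Any (λ l → evalLit σ l ≡ true) C

  SatisfiesRestricted : (Var n m → Bool) → (Fin n → Bool) → Clause n m → Set
  SatisfiesRestricted σ τ C = kept τ C ≡ true → Satisfies σ (residual τ C)

  satisfiable-restrict⇔ : ∀ (F : Formula n m) τ →
    Satisfiable (restrict F (onX τ)) ⇔ (∃[ σ ] All (SatisfiesRestricted σ τ) F)
  satisfiable-restrict⇔ F τ = mk⇔
    (Product.map₂ (All-map-filterB⁻ (kept τ) (residual τ) F))
    (Product.map₂ (All-map-filterB⁺ (kept τ) (residual τ) F))

  satisfiesRestricted-PClause⇔ : ∀ σ τ i v →
    SatisfiesRestricted σ τ (PClause i v) ⇔ (τ v ≡ true → σ (y i) ≡ true)
  satisfiesRestricted-PClause⇔ σ τ i v with τ v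
  ... | true  = mk⇔ (λ h _ → singleton⁻ (h refl)) (λ h _ → here (h refl))
  ... | false = mk⇔ (λ _ ()) (λ _ ())

  satisfiesRestricted-QClause⇔ : ∀ σ τ i v →
    SatisfiesRestricted σ τ (QClause i v) ⇔ (τ v ≡ true → σ (y i) ≡ false)
  satisfiesRestricted-QClause⇔ σ τ i v with τ v
  ... | true  = mk⇔ (λ h _ → not-injective (singleton⁻ (h refl))) (λ h _ → here (cong not (h refl)))
  ... | false = mk⇔ (λ _ ()) (λ _ ())

  Separates : (Var n m → Bool) → (Fin n → Bool) → (Fin m → Biclique n) → Set
  Separates σ τ 𝓑 = ∀ i →
    (∀ v → v ∈ P (𝓑 i) → τ v ≡ true → σ (y i) ≡ true) ×
    (∀ v → v ∈ Q (𝓑 i) → τ v ≡ true → σ (y i) ≡ false)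

  satisfiable⇔separable : ∀ (𝓑 : Fin m → Biclique n) τ →
    Satisfiable (restrict (F𝓑 𝓑) (onX τ)) ⇔ (∃[ σ ] Separates σ τ 𝓑)
  satisfiable⇔separable 𝓑 τ = ⇔.trans (satisfiable-restrict⇔ (F𝓑 𝓑) τ) (mk⇔
    (Product.map₂ λ {σ} h i → Product.map
      (λ hP v v∈P → Equivalence.to (satisfiesRestricted-PClause⇔ σ τ i v) (hP v v∈P))
      (λ hQ v v∈Q → Equivalence.to (satisfiesRestricted-QClause⇔ σ τ i v) (hQ v v∈Q))
      (All-BIS⁻ i (𝓑 i) (All-F𝓑⁻ 𝓑 h i)))
    (Product.map₂ λ {σ} s → All-F𝓑⁺ 𝓑 λ i → All-BIS⁺ i (𝓑 i)
      (λ v v∈P → Equivalence.from (satisfiesRestricted-PClause⇔ σ τ i v) (proj₁ (s i) v v∈P))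
      (λ v v∈Q → Equivalence.from (satisfiesRestricted-QClause⇔ σ τ i v) (proj₂ (s i) v v∈Q))))

  separable⇒independent : ∀ (G : Graph n) (𝓑 : Fin m → Biclique n) {σ τ} →
    (∀ u v → Adj G u v → ∃[ i ] EdgeOf (𝓑 i) u v) → Separates σ τ 𝓑 → IndependentFor G τ
  separable⇒independent G 𝓑 covers s u v τu τv uv with covers u v uv
  ... | i , inj₁ (u∈P , v∈Q) = not-¬ (proj₁ (s i) u u∈P τu) (proj₂ (s i) v v∈Q τv)
  ... | i , inj₂ (u∈Q , v∈P) = not-¬ (proj₁ (s i) v v∈P τv) (proj₂ (s i) u u∈Q τu)

  hasTrueVertex? : (τ : Fin n → Bool) (S : Subset n) → Dec (∃[ u ] u ∈ S × τ u ≡ true)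
  hasTrueVertex? τ S = any? λ u → (u ∈? S) ×-dec (τ u ≟ᵇ true)

  -- The value on X is arbitrary: the restriction to onX τ has removed every X-literal.
  separatingAssignment : (Fin n → Bool) → (Fin m → Biclique n) → Var n m → Bool
  separatingAssignment τ 𝓑 (x _) = true
  separatingAssignment τ 𝓑 (y i) = does (hasTrueVertex? τ (P (𝓑 i)))

  independent⇒separable : ∀ (G : Graph n) (𝓑 : Fin m → Biclique n) {τ} →
    (∀ i → IsBicliqueOf G (𝓑 i)) → IndependentFor G τ → Separates (separatingAssignment τ 𝓑) τ 𝓑
  independent⇒separable G 𝓑 {τ} bicliques independent i =
      (λ v v∈P τv → dec-true (hasTrueVertex? τ (P (𝓑 i))) (v , v∈P , τv))
    , (λ v v∈Q τv → dec-false (hasTrueVertex? τ (P (𝓑 i)))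
        λ (u , u∈P , τu) → independent u v τu τv (proj₂ (bicliques i) u v u∈P v∈Q))

  y∈PClause⇒≡ : ∀ {i j w} → pos (y i) ∈ₗ PClause j w → i ≡ j
  y∈PClause⇒≡ (here ())
  y∈PClause⇒≡ (there (here refl)) = refl
  y∈PClause⇒≡ (there (there ()))

  x∈PClause⇒≡ : ∀ {v j w} → neg (x v) ∈ₗ PClause j w → v ≡ w
  x∈PClause⇒≡ (here refl) = refl
  x∈PClause⇒≡ (there (here ()))
  x∈PClause⇒≡ (there (there ()))

  y∈QClause⇒≡ : ∀ {i j w} → neg (y i) ∈ₗ QClause j w → i ≡ j
  y∈QClause⇒≡ (here refl) = refl
  y∈QClause⇒≡ (there (here ()))
  y∈QClause⇒≡ (there (there ()))

  x∈QClause⇒≡ : ∀ {v j w} → neg (x v) ∈ₗ QClause j w → v ≡ w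
  x∈QClause⇒≡ (here ())
  x∈QClause⇒≡ (there (here refl)) = refl
  x∈QClause⇒≡ (there (there ()))

  y∉QClause : ∀ {i j w} → pos (y i) ∉ₗ QClause j w
  y∉QClause (here ())
  y∉QClause (there (here ()))
  y∉QClause (there (there ()))

  PClause-injective : ∀ {i j v w} → PClause i v ≈C PClause j w → i ≡ j × v ≡ w
  PClause-injective e =
    y∈PClause⇒≡ (Equivalence.to (e _) (there (here refl))) , x∈PClause⇒≡ (Equivalence.to (e _) (here refl))

  QClause-injective : ∀ {i j v w} → QClause i v ≈C QClause j w → i ≡ j × v ≡ w
  QClause-injective e =
    y∈QClause⇒≡ (Equivalence.to (e _) (here refl)) , x∈QClause⇒≡ (Equivalence.to (e _) (there (here refl)))

  PClause≉QClause : ∀ {i j v w} → ¬ (PClause i v ≈C QClause j w)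
  PClause≉QClause e = y∉QClause (Equivalence.to (e _) (there (here refl)))

  QClause≉PClause : ∀ {i j v w} → ¬ (QClause i v ≈C PClause j w)
  QClause≉PClause e = PClause≉QClause (λ l → ⇔.sym (e l))

  BIS-noRepeats : ∀ i B → NoRepeatedClauses (BIS i B)
  BIS-noRepeats i B = AllPairs.++⁺
    (AllPairs.map⁺ (AllPairs.map (λ v≢w e → v≢w (proj₂ (PClause-injective e))) (members-unique (P B))))
    (AllPairs.map⁺ (AllPairs.map (λ v≢w e → v≢w (proj₂ (QClause-injective e))) (members-unique (Q B))))
    (All.map⁺ (All.universal (λ _ → All.map⁺ (All.universal (λ _ → PClause≉QClause) (members (Q B))))
                             (members (P B))))

  BIS-apart : ∀ {i j} B B′ → i ≢ j → All (λ C → All (λ D → ¬ (C ≈C D)) (BIS j B′)) (BIS i B)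
  BIS-apart {i} {j} B B′ i≢j = All-BIS⁺ i B
    (λ _ _ → All-BIS⁺ j B′ (λ _ _ e → i≢j (proj₁ (PClause-injective e))) (λ _ _ → PClause≉QClause))
    (λ _ _ → All-BIS⁺ j B′ (λ _ _ → QClause≉PClause) (λ _ _ e → i≢j (proj₁ (QClause-injective e))))

  F𝓑-noRepeats : ∀ (𝓑 : Fin m → Biclique n) → NoRepeatedClauses (F𝓑 𝓑)
  F𝓑-noRepeats 𝓑 = AllPairs.concat⁺
    (All.map⁺ (All.universal (λ i → BIS-noRepeats i (𝓑 i)) (allFin m)))
    (AllPairs.map⁺ (AllPairs.map (λ {i} {j} → BIS-apart (𝓑 i) (𝓑 j)) (Unique.allFin⁺ m)))

  length-BIS : ∀ i B → length (BIS i B) ≡ ∣V∣ B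
  length-BIS i B = trans (length-++ (map (PClause i) (members (P B)))) (cong₂ _+_
    (trans (length-map (PClause i) (members (P B))) (length-members (P B)))
    (trans (length-map (QClause i) (members (Q B))) (length-members (Q B))))

  length-F𝓑 : ∀ (𝓑 : Fin m → Biclique n) → length (F𝓑 𝓑) ≡ sumV 𝓑
  length-F𝓑 𝓑 = trans (length-concatMap (λ i → BIS i (𝓑 i)) (allFin m))
                      (cong sum (map-cong (λ i → length-BIS i (𝓑 i)) (allFin m)))

proposition8 : ∀ {n m : ℕ} (G : Graph n) (𝓑 : Fin m → Biclique n) →
                 IsBicliqueCovering G 𝓑 →
                 EncodesIS G (F𝓑 𝓑) × HasSize (F𝓑 𝓑) (sumV 𝓑)
proposition8 G 𝓑 (bicliques , covers) = encodes , F𝓑-noRepeats 𝓑 , length-F𝓑 𝓑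
  where
  encodes : EncodesIS G (F𝓑 𝓑)
  encodes τ = mk⇔
    (λ sat → let (σ , separates) = Equivalence.to (satisfiable⇔separable 𝓑 τ) sat
             in separable⇒independent G 𝓑 {σ} {τ} covers separates)
    (λ independent → Equivalence.from (satisfiable⇔separable 𝓑 τ)
      (separatingAssignment τ 𝓑 , independent⇒separable G 𝓑 bicliques independent))
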